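{- Let $t$ be a term. Then: (i) $t$ is $\rhd\mathsf{shuf}$-normal if and only if $t\in\Lambda_n$; (ii) $t$ is $\rhd\mathsf{shuf}$-normal and is neither a value nor a $\beta$-redex if and only if $t\in\Lambda_a$.
   Context: Terms: $t ::= x \mid \lambda x.t \mid tu$ (up to $\alpha$); values $v ::= x \mid \lambda x.t$; a $\beta$-redex is a term of the form $(\lambda x.t)u$. $\mathrm{Fv}(t)$ free variables; $t\{v/x\}$ substitution. Root steps: ($\beta_v$) $(\lambda x.t)v \mapsto t\{v/x\}$, $v$ a value; ($\sigma_1$) $(\lambda x.t)us \mapsto (\lambda x.ts)u$ if $x\notin\mathrm{Fv}(s)$; ($\sigma_3$) $v((\lambda x.s)u)\mapsto(\lambda x.vs)u$ if $v$ a value, $x\notin\mathrm{Fv}(v)$ (side conditions always satisfiable by $\alpha$-renaming). Balanced contexts $B ::= [\cdot] \mid (\lambda x.B)t \mid Bt \mid tB$; $\rhd\mathsf{shuf}$-reduction is the closure of the union of the three root steps under balanced contexts; a term is $\rhd\mathsf{shuf}$-normal if no such step applies. The sets $\Lambda_a$ and $\Lambda_n$ are defined by mutual induction: $a ::= xv \mid xa \mid an$ (set $\Lambda_a$) and $n ::= v \mid a \mid (\lambda x.n)a$ (set $\Lambda_n$), where $x$ ranges over variables and $v$ over values. -}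

module Defs where

open import Data.Nat using (ℕ; zero; suc; pred; _<ᵇ_)
open import Data.Bool using (if_then_else_; true; false)
open import Data.Product using (∃)
open import Relation.Nullary using (¬_)

-- Pure λ-terms up to α-equivalence, represented with de Bruijn indices.
data Term : Set where
  var : ℕ → Term
  lam : Term → Term
  app : Term → Term → Term

data Value : Term → Set where
  v-var : ∀ n → Value (var n)
  v-lam : ∀ t → Value (lam t)

data BetaRedex : Term → Set where
  redex : ∀ t u → BetaRedex (app (lam t) u)

-- Shifting: increment free indices ≥ c by 1 (weakening; realises x ∉ Fv(s)).
shift : ℕ → Term → Term
shift c (var n) = if n <ᵇ c then var n else var (suc n)
shift c (lam t) = lam (shift (suc c) t)
shift c (app t u) = app (shift c t) (shift c u)

subst : ℕ → Term → Term → Term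
subst k s (var n) with n <ᵇ k | k <ᵇ n
... | true  | _     = var n
... | false | true  = var (pred n)
... | false | false = s
subst k s (lam t) = lam (subst (suc k) (shift 0 s) t)
subst k s (app t u) = app (subst k s t) (subst k s u)

data Root : Term → Term → Set where
  βv : ∀ {t v} → Value v → Root (app (lam t) v) (subst 0 v t)
  -- (σ₁) (λx.t)us ↦ (λx.ts)u, x ∉ Fv(s)
  σ₁ : ∀ t u s → Root (app (app (lam t) u) s) (app (lam (app t (shift 0 s))) u)
  -- (σ₃) v((λx.s)u) ↦ (λx.vs)u, v a value, x ∉ Fv(v)
  σ₃ : ∀ {v} s u → Value v → Root (app v (app (lam s) u)) (app (lam (app (shift 0 v) s)) u)

-- Closure under balanced contexts B ::= [·] | (λx.B)t | Bt | tB.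
data _▷shuf_ : Term → Term → Set where
  root   : ∀ {t t'} → Root t t' → t ▷shuf t'
  ctx-λ  : ∀ {t t'} u → t ▷shuf t' → app (lam t) u ▷shuf app (lam t') u
  ctx-l  : ∀ {t t'} u → t ▷shuf t' → app t u ▷shuf app t' u
  ctx-r  : ∀ {u u'} t → u ▷shuf u' → app t u ▷shuf app t u'

Normal : Term → Set
Normal t = ¬ ∃ (λ t' → t ▷shuf t')

data Λa : Term → Set
data Λn : Term → Set

data Λa where
  xv : ∀ x {v} → Value v → Λa (app (var x) v)
  xa : ∀ x {a} → Λa a → Λa (app (var x) a)
  an : ∀ {a n} → Λa a → Λn n → Λa (app a n)

data Λn where
  n-val : ∀ {v} → Value v → Λn v
  n-a   : ∀ {a} → Λa a → Λn a
  n-λa  : ∀ {n a} → Λn n → Λa a → Λn (app (lam n) a)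

module Submission where

open import Defs
open import Data.Empty using (⊥; ⊥-elim)
open import Data.Product using (_×_; _,_)
open import Function.Bundles using (_⇔_; mk⇔)
open import Relation.Nullary using (¬_)

-- Soundness: no root step fits a term of Λa or Λn, because the head of an
-- application in Λa is never an abstraction and its argument is never a
-- value or a β-redex where βv or σ₃ would need one.  Completeness: a normal
-- (λx.s)u forces u to be neither a value (βv) nor a β-redex (σ₃), a normal
-- x u forces u not to be a β-redex (σ₃), and a normal (t₁ t₂)u forces t₁ t₂
-- not to be a β-redex (σ₁); the grammar of Λa and Λn records exactly this.

value-¬step : ∀ {v t} → Value v → ¬ (v ▷shuf t)
value-¬step (v-var _) (root ())
value-¬step (v-lam _) (root ())

Λa-¬Value : ∀ {t} → Λa t → ¬ Value t
Λa-¬Value (xv _ _) ()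
Λa-¬Value (xa _ _) ()
Λa-¬Value (an _ _) ()

Λa-¬BetaRedex : ∀ {t} → Λa t → ¬ BetaRedex t
Λa-¬BetaRedex (an () _) (redex _ _)

mutual
  Λa-¬step : ∀ {a t} → Λa a → ¬ (a ▷shuf t)
  Λa-¬step (xv _ ()) (root (σ₃ _ _ _))
  Λa-¬step (xv x _)  (ctx-l _ st) = value-¬step (v-var x) st
  Λa-¬step (xv _ v)  (ctx-r _ st) = value-¬step v st
  Λa-¬step (xa _ a)  (root (σ₃ s u _)) = Λa-¬BetaRedex a (redex s u)
  Λa-¬step (xa x _)  (ctx-l _ st) = value-¬step (v-var x) st
  Λa-¬step (xa _ a)  (ctx-r _ st) = Λa-¬step a st
  Λa-¬step (an a _)  (root (βv _)) = Λa-¬Value a (v-lam _)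
  Λa-¬step (an a _)  (root (σ₁ t u _)) = Λa-¬BetaRedex a (redex t u)
  Λa-¬step (an a _)  (root (σ₃ _ _ v)) = Λa-¬Value a v
  Λa-¬step (an a _)  (ctx-λ _ _) = Λa-¬Value a (v-lam _)
  Λa-¬step (an a _)  (ctx-l _ st) = Λa-¬step a st
  Λa-¬step (an _ n)  (ctx-r _ st) = Λn-¬step n st

  Λn-¬step : ∀ {n t} → Λn n → ¬ (n ▷shuf t)
  Λn-¬step (n-val v)  st = value-¬step v st
  Λn-¬step (n-a a)    st = Λa-¬step a st
  Λn-¬step (n-λa _ a) (root (βv v)) = Λa-¬Value a v
  Λn-¬step (n-λa _ a) (root (σ₃ s u _)) = Λa-¬BetaRedex a (redex s u)
  Λn-¬step (n-λa n _) (ctx-λ _ st) = Λn-¬step n st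
  Λn-¬step (n-λa _ _) (ctx-l _ st) = value-¬step (v-lam _) st
  Λn-¬step (n-λa _ a) (ctx-r _ st) = Λa-¬step a st

Λa⇒Normal : ∀ {t} → Λa t → Normal t
Λa⇒Normal a (_ , st) = Λa-¬step a st

Λn⇒Normal : ∀ {t} → Λn t → Normal t
Λn⇒Normal n (_ , st) = Λn-¬step n st

Normal-appˡ : ∀ {t u} → Normal (app t u) → Normal t
Normal-appˡ {u = u} nf (_ , st) = nf (_ , ctx-l u st)

Normal-appʳ : ∀ {t u} → Normal (app t u) → Normal u
Normal-appʳ {t = t} nf (_ , st) = nf (_ , ctx-r t st)

Normal-redex-body : ∀ {s u} → Normal (app (lam s) u) → Normal s
Normal-redex-body {u = u} nf (_ , st) = nf (_ , ctx-λ u st)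

data Shape : Term → Set where
  value   : ∀ {t} → Value t → Shape t
  β-redex : ∀ s u → Shape (app (lam s) u)
  other   : ∀ {t} → ¬ Value t → ¬ BetaRedex t → Shape t

shape : ∀ t → Shape t
shape (var x)             = value (v-var x)
shape (lam s)             = value (v-lam s)
shape (app (lam s) u)     = β-redex s u
shape (app (var x) u)     = other (λ ()) (λ ())
shape (app (app t₁ t₂) u) = other (λ ()) (λ ())

mutual
  Normal⇒Λn : ∀ t → Normal t → Λn t
  Normal⇒Λn t nf with shape t
  ... | value v     = n-val v
  ... | β-redex s u = n-λa (Normal⇒Λn s (Normal-redex-body nf))
                           (Normal⇒Λa u (Normal-appʳ nf) ¬value ¬redex)
    where
    ¬value : ¬ Value u
    ¬value v = nf (_ , root (βv v))

    ¬redex : ¬ BetaRedex u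
    ¬redex (redex s′ w) = nf (_ , root (σ₃ s′ w (v-lam s)))
  ... | other ¬v ¬r = n-a (Normal⇒Λa t nf ¬v ¬r)

  Normal⇒Λa : ∀ t → Normal t → ¬ Value t → ¬ BetaRedex t → Λa t
  Normal⇒Λa (var x)   _ ¬v _ = ⊥-elim (¬v (v-var x))
  Normal⇒Λa (lam s)   _ ¬v _ = ⊥-elim (¬v (v-lam s))
  Normal⇒Λa (app (lam s) u) _ _ ¬r = ⊥-elim (¬r (redex s u))
  Normal⇒Λa (app (var x) u) nf _ _ with shape u
  ... | value v     = xv x v
  ... | β-redex s w = ⊥-elim (nf (_ , root (σ₃ s w (v-var x))))
  ... | other ¬v ¬r = xa x (Normal⇒Λa u (Normal-appʳ nf) ¬v ¬r)
  Normal⇒Λa (app (app t₁ t₂) u) nf _ _ =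
    an (Normal⇒Λa (app t₁ t₂) (Normal-appˡ nf) (λ ()) ¬redex)
       (Normal⇒Λn u (Normal-appʳ nf))
    where
    ¬redex : ¬ BetaRedex (app t₁ t₂)
    ¬redex (redex s _) = nf (_ , root (σ₁ s t₂ u))

mainTheorem11 : (t : Term)
    → (Normal t ⇔ Λn t)
    × ((Normal t × ¬ Value t × ¬ BetaRedex t) ⇔ Λa t)
mainTheorem11 t =
  mk⇔ (Normal⇒Λn t) Λn⇒Normal ,
  mk⇔ (λ (nf , ¬v , ¬r) → Normal⇒Λa t nf ¬v ¬r)
      (λ a → Λa⇒Normal a , Λa-¬Value a , Λa-¬BetaRedex a)
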